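{- Let $q$ be a prime power with $\mathrm{char}\,\mathbb{F}_q\ne 2,3$ and $q>7$, and let \[ f(X)=aX^2+bX+\frac{1}{X-r}+\frac{1}{X+r}, \] where $a\in\mathbb{F}_q^*$, $b\in\mathbb{F}_q$, $r\in\mathbb{F}_{q^2}\setminus\mathbb{F}_q$ and $r^2\in\mathbb{F}_q$. Then $f$ is not a permutation rational function of $\mathbb{P}^1(\mathbb{F}_q)$.
   Context: $\mathbb{P}^1(\mathbb{F}_q)=\mathbb{F}_q\cup\{\infty\}$ is the projective line over $\mathbb{F}_q$. A rational function $f=P/Q\in\mathbb{F}_q(X)$ ($P,Q$ coprime) defines a map $\mathbb{P}^1(\mathbb{F}_q)\to\mathbb{P}^1(\mathbb{F}_q)$ in the usual way (zeros of $Q$ map to $\infty$, and $f(\infty)$ is the limiting value). A permutation rational function of $\mathbb{P}^1(\mathbb{F}_q)$ is a rational function whose induced map on $\mathbb{P}^1(\mathbb{F}_q)$ is a bijection. -}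

module Defs where

open import Data.Nat using (ℕ; zero; suc; _<_; _>_)
open import Data.Nat.Properties using (<-cmp)
open import Data.Fin using (Fin)
open import Data.List using (List; []; _∷_; foldr)
open import Data.Maybe using (Maybe; just; nothing)
open import Data.Product using (_×_; _,_; ∃)
open import Relation.Binary.PropositionalEquality using (_≡_; _≢_)
open import Relation.Binary.Definitions using (DecidableEquality; tri<; tri≈; tri>)
open import Relation.Nullary using (yes; no; ¬_)
open import Algebra.Structures using (IsCommutativeRing)
open import Function.Bundles using (_⤖_)
open import Function.Definitions using (Bijective)

-- A finite field: a commutative ring (with propositional equality) in which
-- 0 ≠ 1 and every nonzero element has an inverse, with decidable equality
-- and an explicit bijection Fin size ⤖ Carrier (so q = size).
-- The inverse is a total function; its value at 0 is irrelevant.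
record FiniteField : Set₁ where
  infixl 6 _+_
  infixl 7 _*_
  field
    Carrier : Set
    _+_ _*_ : Carrier → Carrier → Carrier
    -_ : Carrier → Carrier
    0# 1# : Carrier
    _⁻¹ : Carrier → Carrier
    isCommutativeRing : IsCommutativeRing _≡_ _+_ _*_ -_ 0# 1#
    0≢1 : 0# ≢ 1#
    ⁻¹-inverse : ∀ x → x ≢ 0# → x * (x ⁻¹) ≡ 1#
    _≟_ : DecidableEquality Carrier
    size : ℕ
    enum : Fin size ⤖ Carrier

module _ (F : FiniteField) where
  open FiniteField F

  -- polynomials over F as little-endian coefficient lists
  Poly : Set
  Poly = List Carrier

  eval : Poly → Carrier → Carrier
  eval p x = foldr (λ c acc → c + x * acc) 0# p

  -- degree and leading coefficient of a nonzero polynomial (nothing for 0)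
  lead : Poly → Maybe (ℕ × Carrier)
  lead [] = nothing
  lead (c ∷ cs) with lead cs
  ... | just (d , l) = just (suc d , l)
  ... | nothing with c ≟ 0#
  ...   | yes _ = nothing
  ...   | no _ = just (0 , c)

  -- projective line P¹(F) = F ∪ {∞}, with nothing = ∞
  P1 : Set
  P1 = Maybe Carrier

  -- map P¹ → P¹ induced by P/Q (P, Q coprime): zeros of Q go to ∞,
  -- ∞ goes to the limiting value determined by degrees / leading coefficients
  ratMapInf : Maybe (ℕ × Carrier) → Maybe (ℕ × Carrier) → P1
  ratMapInf nothing _ = just 0#
  ratMapInf (just _) nothing = nothing
  ratMapInf (just (dp , lp)) (just (dq , lq)) with <-cmp dp dq
  ... | tri< _ _ _ = just 0#
  ... | tri≈ _ _ _ = just (lp * (lq ⁻¹))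
  ... | tri> _ _ _ = nothing

  ratMap : Poly → Poly → P1 → P1
  ratMap P Q nothing = ratMapInf (lead P) (lead Q)
  ratMap P Q (just x) with eval Q x ≟ 0#
  ... | yes _ = nothing
  ... | no _ = just (eval P x * (eval Q x ⁻¹))

  IsPermutationRational : Poly → Poly → Set
  IsPermutationRational P Q = Bijective _≡_ _≡_ (ratMap P Q)

  IsSquare : Carrier → Set
  IsSquare s = ∃ λ t → t * t ≡ s

  two : Carrier
  two = 1# + 1#

  -- With s = r², f = aX² + bX + 1/(X-r) + 1/(X+r) = P/Q where
  --   P = (aX² + bX)(X² - s) + 2X = aX⁴ + bX³ - asX² + (2 - bs)X,
  --   Q = X² - s.
  fNum : Carrier → Carrier → Carrier → Poly
  fNum a b s = 0# ∷ (two + (- (b * s))) ∷ (- (a * s)) ∷ b ∷ a ∷ []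

  fDen : Carrier → Poly
  fDen s = (- s) ∷ 0# ∷ 1# ∷ []

module Submission where

open import Defs
open import Data.Nat using (_<_)
open import Relation.Binary.PropositionalEquality using (_≢_)
open import Relation.Nullary using (¬_)

open import Data.Nat as ℕ using (ℕ; zero; suc; _≤_; s≤s)
import Data.Nat.Properties as ℕ
open import Data.Integer as ℤ using (ℤ; -[1+_]; _⊖_) renaming (+_ to pos)
import Data.Integer.Properties as ℤ
open import Data.Sign as Sign using (Sign)
open import Data.Fin as Fin using (Fin)
import Data.Fin.Properties as Fin
open import Data.Fin.Permutation using (Permutation; permutation)
open import Data.List using (List; []; _∷_; _++_; length; lookup)
import Data.List.Properties as List
open import Data.List.Membership.Propositional using (_∈_)
open import Data.List.Membership.Propositional.Properties using (∈-++⁺ˡ; ∈-++⁺ʳ)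
open import Data.List.Relation.Unary.Any as Any using (here; there)
open import Data.List.Relation.Unary.Any.Properties using (lookup-index)
open import Data.Maybe using (Maybe; just; nothing)
open import Data.Product using (_×_; _,_; proj₁; proj₂; Σ-syntax)
open import Data.Maybe.Properties using (just-injective)
open import Data.Sum using (_⊎_; inj₁; inj₂)
open import Data.Empty using (⊥-elim)
open import Function using (_∘_; id)
open import Function.Bundles using (_↔_; Inverse)
open import Function.Properties.Bijection using (⤖⇒↔)
open import Relation.Nullary using (yes; no)
open import Relation.Binary.PropositionalEquality
open import Algebra.Bundles using (CommutativeRing; Semiring)
open import Algebra.Structures using (IsCommutativeRing)
import Algebra.Solver.Ring.AlmostCommutativeRing as ACR

-- Proof by power sums.  On F, f(x) = φ(x) = a x² + b x + 2x u(x), where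
-- u(x) = 1/(x² - s) is defined everywhere because s is not a square, and
-- f(∞) = ∞.  A permutation f of P¹ would therefore permute F, forcing
-- Σ φ(x)ⁿ = Σ xⁿ for every n.  Constants, odd functions and (for q > 7)
-- x², x⁴, x⁶ all sum to 0, so expanding φ² and φ³ with the help of
-- (x² - s) u(x) = 1 leaves two linear equations in S₁ = Σ u and S₂ = Σ u²:
--   (4bs + 4) S₁ + 4s S₂ = Σ x² = 0,   (12abs² + 24as) S₁ + 12as² S₂ = Σ x³ = 0,
-- whose combination gives 12 a s S₁ = 0.  But the involution x ↦ s/x of F
-- shows 2 S₁ = -1/s, so S₁ ≠ 0: a contradiction.

-- The integers map homomorphically into every commutative ring (with
-- propositional equality); this makes the standard ring solver available
-- with integer coefficients, so that identities such as (x+y)² = x² + 2xy + y²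
-- can be discharged by normalisation.
module IntegerSolver {A : Set} {plus times : A → A → A} {minus : A → A} {nought unit : A}
  (isCommutativeRing : IsCommutativeRing _≡_ plus times minus nought unit) where

  ring : CommutativeRing _ _
  ring = record { isCommutativeRing = isCommutativeRing }

  open CommutativeRing ring public using (_+_; _*_; -_; 0#; 1#; semiring)
  open IsCommutativeRing isCommutativeRing public hiding (refl; sym; trans)
  open import Algebra.Properties.Ring (CommutativeRing.ring ring) public
  open import Algebra.Definitions.RawSemiring (Semiring.rawSemiring semiring) public using (_^_)
  open import Algebra.Properties.CommutativeSemigroup (CommutativeRing.+-commutativeSemigroup ring)
    using (interchange)
  open import Algebra.Properties.CommutativeSemigroup (CommutativeRing.*-commutativeSemigroup ring)
    using () renaming (interchange to *-interchange)
  open import Algebra.Properties.Semiring.Mult.TCOptimised semiring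
    using (1+×; ×-homo-+; ×1-homo-*) renaming (_×_ to _·_)

  -- The canonical map ℤ → A, where n · x = x + ⋯ + x (n times) is chosen
  -- so that 1 · 1# = 1# and 2 · 1# = 1# + 1# hold definitionally.
  ι : ℤ → A
  ι (pos n)  = n · 1#
  ι -[1+ n ] = - (suc n · 1#)

  ι-⊖ : ∀ m n → ι (m ⊖ n) ≡ m · 1# - n · 1#
  ι-⊖ zero    zero    = sym (trans (cong (0# +_) -0#≈0#) (+-identityʳ 0#))
  ι-⊖ zero    (suc n) = sym (+-identityˡ _)
  ι-⊖ (suc m) zero    = sym (trans (cong (suc m · 1# +_) -0#≈0#) (+-identityʳ _))
  ι-⊖ (suc m) (suc n) = begin
    ι (suc m ⊖ suc n)              ≡⟨ cong ι (ℤ.[1+m]⊖[1+n]≡m⊖n m n) ⟩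
    ι (m ⊖ n)                      ≡⟨ ι-⊖ m n ⟩
    m′ - n′                        ≡⟨ sym (+-identityˡ _) ⟩
    0# + (m′ - n′)                 ≡⟨ cong (_+ (m′ - n′)) (sym (-‿inverseʳ 1#)) ⟩
    (1# - 1#) + (m′ - n′)          ≡⟨ interchange 1# (- 1#) m′ (- n′) ⟩
    (1# + m′) + (- 1# + - n′)      ≡⟨ cong₂ _+_ (sym (1+× m 1#)) (-‿+-comm 1# n′) ⟩
    suc m · 1# + - (1# + n′)       ≡⟨ cong (λ y → suc m · 1# - y) (sym (1+× n 1#)) ⟩
    suc m · 1# - suc n · 1#        ∎
    where
    open ≡-Reasoning
    m′ n′ : A
    m′ = m · 1#
    n′ = n · 1#

  ι-+ : ∀ i j → ι (i ℤ.+ j) ≡ ι i + ι j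
  ι-+ (pos m)  (pos n)  = ×-homo-+ 1# m n
  ι-+ (pos m)  -[1+ n ] = ι-⊖ m (suc n)
  ι-+ -[1+ m ] (pos n)  = trans (ι-⊖ n (suc m)) (+-comm _ _)
  ι-+ -[1+ m ] -[1+ n ] = begin
    - (suc (suc (m ℕ.+ n)) · 1#)      ≡⟨ cong (λ k → - (suc k · 1#)) (sym (ℕ.+-suc m n)) ⟩
    - ((suc m ℕ.+ suc n) · 1#)        ≡⟨ cong -_ (×-homo-+ 1# (suc m) (suc n)) ⟩
    - (suc m · 1# + suc n · 1#)       ≡⟨ sym (-‿+-comm _ _) ⟩
    - (suc m · 1#) + - (suc n · 1#)   ∎
    where open ≡-Reasoning

  ι-neg : ∀ i → ι (ℤ.- i) ≡ - ι i
  ι-neg (pos zero)    = sym -0#≈0#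
  ι-neg (pos (suc n)) = refl
  ι-neg -[1+ n ]      = sym (-‿involutive _)

  -- Multiplicativity is checked on the decomposition i = sign i ◃ ∣ i ∣.
  σ : Sign → A
  σ Sign.+ = 1#
  σ Sign.- = - 1#

  σ-* : ∀ s t → σ (s Sign.* t) ≡ σ s * σ t
  σ-* Sign.+ t      = sym (*-identityˡ _)
  σ-* Sign.- Sign.+ = sym (*-identityʳ _)
  σ-* Sign.- Sign.- = sym (trans (-1*x≈-x (- 1#)) (-‿involutive 1#))

  ι-◃ : ∀ s n → ι (s ℤ.◃ n) ≡ σ s * (n · 1#)
  ι-◃ s      zero    = sym (zeroʳ _)
  ι-◃ Sign.+ (suc n) = sym (*-identityˡ _)
  ι-◃ Sign.- (suc n) = sym (-1*x≈-x _)

  ι-sign : ∀ i → ι i ≡ σ (ℤ.sign i) * (ℤ.∣ i ∣ · 1#)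
  ι-sign i = trans (cong ι (sym (ℤ.◃-inverse i))) (ι-◃ (ℤ.sign i) ℤ.∣ i ∣)

  ι-* : ∀ i j → ι (i ℤ.* j) ≡ ι i * ι j
  ι-* i j = begin
    ι (sᵢ Sign.* sⱼ ℤ.◃ ℤ.∣ i ∣ ℕ.* ℤ.∣ j ∣)        ≡⟨ ι-◃ (sᵢ Sign.* sⱼ) (ℤ.∣ i ∣ ℕ.* ℤ.∣ j ∣) ⟩
    σ (sᵢ Sign.* sⱼ) * ((ℤ.∣ i ∣ ℕ.* ℤ.∣ j ∣) · 1#)  ≡⟨ cong₂ _*_ (σ-* sᵢ sⱼ) (×1-homo-* ℤ.∣ i ∣ ℤ.∣ j ∣) ⟩
    (σ sᵢ * σ sⱼ) * (nᵢ * nⱼ)                      ≡⟨ *-interchange (σ sᵢ) (σ sⱼ) nᵢ nⱼ ⟩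
    (σ sᵢ * nᵢ) * (σ sⱼ * nⱼ)                      ≡⟨ cong₂ _*_ (sym (ι-sign i)) (sym (ι-sign j)) ⟩
    ι i * ι j                                      ∎
    where
    open ≡-Reasoning
    sᵢ sⱼ : Sign
    sᵢ = ℤ.sign i
    sⱼ = ℤ.sign j
    nᵢ nⱼ : A
    nᵢ = ℤ.∣ i ∣ · 1#
    nⱼ = ℤ.∣ j ∣ · 1#

  homomorphism : ℤ.+-*-rawRing ACR.-Raw-AlmostCommutative⟶ ACR.fromCommutativeRing ring
  homomorphism = record
    { ⟦_⟧ = ι ; +-homo = ι-+ ; *-homo = ι-* ; -‿homo = ι-neg ; 0-homo = refl ; 1-homo = refl }

  ι-≟ : ∀ i j → Maybe (ι i ≡ ι j)
  ι-≟ i j with i ℤ.≟ j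
  ... | yes refl = just refl
  ... | no _     = nothing

  open import Algebra.Solver.Ring ℤ.+-*-rawRing (ACR.fromCommutativeRing ring) homomorphism ι-≟ public

  -- Integer constants of A, as they appear in solver terms (con (pos n)).
  infix 10 #_
  #_ : ℕ → A
  # n = ι (pos n)


module FieldArithmetic (F : FiniteField) where
  open FiniteField F public hiding (isCommutativeRing)
  open IntegerSolver (FiniteField.isCommutativeRing F) public hiding (_+_; _*_; -_; 0#; 1#)

  cancel-nonzero : ∀ {c y} → c ≢ 0# → c * y ≡ 0# → y ≡ 0#
  cancel-nonzero {c} {y} c≢0 cy≡0 = begin
    y                ≡⟨ sym (*-identityˡ y) ⟩
    1# * y           ≡⟨ cong (_* y) (sym (trans (*-comm _ _) (⁻¹-inverse c c≢0))) ⟩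
    (c ⁻¹ * c) * y   ≡⟨ *-assoc _ _ _ ⟩
    c ⁻¹ * (c * y)   ≡⟨ cong (c ⁻¹ *_) cy≡0 ⟩
    c ⁻¹ * 0#        ≡⟨ zeroʳ _ ⟩
    0#               ∎
    where open ≡-Reasoning

  zero-product : ∀ {x y} → x * y ≡ 0# → x ≡ 0# ⊎ y ≡ 0#
  zero-product {x} xy≡0 with x ≟ 0#
  ... | yes x≡0 = inj₁ x≡0
  ... | no x≢0  = inj₂ (cancel-nonzero x≢0 xy≡0)

  nonzero-* : ∀ {x y} → x ≢ 0# → y ≢ 0# → x * y ≢ 0#
  nonzero-* x≢0 y≢0 xy≡0 with zero-product xy≡0
  ... | inj₁ x≡0 = x≢0 x≡0
  ... | inj₂ y≡0 = y≢0 y≡0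

  inverse-unique : ∀ {y w} → y * w ≡ 1# → y ⁻¹ ≡ w
  inverse-unique {y} {w} yw≡1 = begin
    y ⁻¹             ≡⟨ sym (*-identityʳ _) ⟩
    y ⁻¹ * 1#        ≡⟨ cong (y ⁻¹ *_) (sym yw≡1) ⟩
    y ⁻¹ * (y * w)   ≡⟨ sym (*-assoc _ _ _) ⟩
    (y ⁻¹ * y) * w   ≡⟨ cong (_* w) (trans (*-comm _ _) (⁻¹-inverse y y≢0)) ⟩
    1# * w           ≡⟨ *-identityˡ w ⟩
    w                ∎
    where
    open ≡-Reasoning
    y≢0 : y ≢ 0#
    y≢0 y≡0 = 0≢1 (trans (sym (zeroˡ w)) (trans (cong (_* w) (sym y≡0)) yw≡1))

  ⁻¹-nonzero : ∀ {x} → x ≢ 0# → x ⁻¹ ≢ 0#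
  ⁻¹-nonzero {x} x≢0 x⁻¹≡0 = 0≢1 (begin
    0#          ≡⟨ sym (zeroʳ x) ⟩
    x * 0#      ≡⟨ cong (x *_) (sym x⁻¹≡0) ⟩
    x * x ⁻¹    ≡⟨ ⁻¹-inverse x x≢0 ⟩
    1#          ∎)
    where open ≡-Reasoning

  twelve≢0 : 1# + 1# ≢ 0# → (1# + 1#) + 1# ≢ 0# → # 12 ≢ 0#
  twelve≢0 two≢0 three≢0 12≡0 = nonzero-* (nonzero-* two≢0 two≢0) three≢0 (trans (sym twelve) 12≡0)
    where
    twelve : # 12 ≡ ((1# + 1#) * (1# + 1#)) * ((1# + 1#) + 1#)
    twelve = solve 0 (con (pos 12) := (con (pos 2) :* con (pos 2)) :* con (pos 3)) refl

  -- A relation p = 1 lets any multiple of p - 1 be dropped; polynomial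
  -- identities that hold "modulo p - 1" are used through this lemma.
  modulo : ∀ {p l r} m → p ≡ 1# → l ≡ r + m * (p - 1#) → l ≡ r
  modulo {p} {l} {r} m p≡1 l≡r+m[p-1] = begin
    l                    ≡⟨ l≡r+m[p-1] ⟩
    r + m * (p - 1#)     ≡⟨ cong (λ p → r + m * (p - 1#)) p≡1 ⟩
    r + m * (1# - 1#)    ≡⟨ cong (λ z → r + m * z) (-‿inverseʳ 1#) ⟩
    r + m * 0#           ≡⟨ cong (r +_) (zeroʳ m) ⟩
    r + 0#               ≡⟨ +-identityʳ r ⟩
    r                    ∎
    where open ≡-Reasoning

module Summation (F : FiniteField) where
  open FieldArithmetic F public
  open import Algebra.Properties.Semiring.Sum semiring
    using (sum; sum-cong-≗; sum-replicate-zero; ∑-distrib-+; *-distribˡ-sum; sum-permute)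

  enumeration : Fin size ↔ Carrier
  enumeration = ⤖⇒↔ enum
  open Inverse enumeration public using (to; from; strictlyInverseˡ; strictlyInverseʳ)

  Σ : (Carrier → Carrier) → Carrier
  Σ h = sum (h ∘ to)

  Σ-cong : ∀ {g h} → (∀ x → g x ≡ h x) → Σ g ≡ Σ h
  Σ-cong g≗h = sum-cong-≗ (g≗h ∘ to)

  Σ-+ : ∀ g h → Σ (λ x → g x + h x) ≡ Σ g + Σ h
  Σ-+ g h = ∑-distrib-+ (g ∘ to) (h ∘ to)

  Σ-* : ∀ c h → Σ (λ x → c * h x) ≡ c * Σ h
  Σ-* c h = sym (*-distribˡ-sum c (h ∘ to))

  Σ-reindex : ∀ (σ τ : Carrier → Carrier) → (∀ x → τ (σ x) ≡ x) → (∀ y → σ (τ y) ≡ y) →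
              ∀ h → Σ (h ∘ σ) ≡ Σ h
  Σ-reindex σ τ τσ στ h = sym (trans (sum-permute (h ∘ to) π) (Σ-cong (cong h ∘ strictlyInverseˡ ∘ σ)))
    where
    conj : (Carrier → Carrier) → Fin size → Fin size
    conj ρ = from ∘ ρ ∘ to
    cancels : ∀ ρ ρ′ → (∀ y → ρ (ρ′ y) ≡ y) → ∀ i → conj ρ (conj ρ′ i) ≡ i
    cancels ρ ρ′ ρρ′ i = trans (cong (from ∘ ρ) (strictlyInverseˡ (ρ′ (to i))))
                               (trans (cong from (ρρ′ (to i))) (strictlyInverseʳ i))
    π : Permutation size size
    π = permutation (conj σ) (conj τ) (cancels σ τ στ) (cancels τ σ τσ)

  Σ-single : ∀ h c → (∀ x → x ≢ c → h x ≡ 0#) → Σ h ≡ h c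
  Σ-single h c vanish = trans (sum-single (h ∘ to) (from c) vanish′) (cong h (strictlyInverseˡ c))
    where
    vanish′ : ∀ i → i ≢ from c → h (to i) ≡ 0#
    vanish′ i i≢c = vanish (to i) (λ x≡c → i≢c (trans (sym (strictlyInverseʳ i)) (cong from x≡c)))
    sum-single : ∀ {n} (g : Fin n → Carrier) i → (∀ j → j ≢ i → g j ≡ 0#) → sum g ≡ g i
    sum-single {suc n} g Fin.zero vanish =
      trans (cong (g Fin.zero +_) (trans (sum-cong-≗ (λ j → vanish (Fin.suc j) (λ ())))
                                         (sum-replicate-zero n)))
            (+-identityʳ _)
    sum-single g (Fin.suc i) vanish =
      trans (cong₂ _+_ (vanish Fin.zero (λ ()))
                       (sum-single (g ∘ Fin.suc) i (λ j j≢i → vanish (Fin.suc j) (j≢i ∘ Fin.suc-injective))))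
            (+-identityˡ _)

  -- Σ 1 = 0, because translation by 1 permutes F: Σ x = Σ (x + 1) = Σ x + Σ 1.
  Σ-one : Σ (λ _ → 1#) ≡ 0#
  Σ-one = +-identityʳ-unique (Σ id) (Σ (λ _ → 1#)) (trans (sym (Σ-+ id (λ _ → 1#)))
            (Σ-reindex (_+ 1#) (_- 1#) (λ x → shift-back x 1#) (λ x → shift-forth x 1#) id))
    where
    shift-back : ∀ x c → (x + c) - c ≡ x
    shift-back = solve 2 (λ x c → (x :+ c) :- c := x) refl
    shift-forth : ∀ x c → (x - c) + c ≡ x
    shift-forth = solve 2 (λ x c → (x :- c) :+ c := x) refl

  Σ-const : ∀ c → Σ (λ _ → c) ≡ 0#
  Σ-const c = begin
    Σ (λ _ → c)        ≡⟨ Σ-cong (λ _ → sym (*-identityʳ c)) ⟩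
    Σ (λ _ → c * 1#)   ≡⟨ Σ-* c (λ _ → 1#) ⟩
    c * Σ (λ _ → 1#)   ≡⟨ cong (c *_) Σ-one ⟩
    c * 0#             ≡⟨ zeroʳ c ⟩
    0#                 ∎
    where open ≡-Reasoning

  -- In odd characteristic an odd function sums to 0: negation permutes F,
  -- so Σ h = Σ (h ∘ -_) = - Σ h.
  Σ-odd : 1# + 1# ≢ 0# → ∀ h → (∀ x → h (- x) ≡ - h x) → Σ h ≡ 0#
  Σ-odd two≢0 h odd = cancel-nonzero two≢0 (begin
    (1# + 1#) * Σ h      ≡⟨ distribʳ (Σ h) 1# 1# ⟩
    1# * Σ h + 1# * Σ h  ≡⟨ cong₂ _+_ (*-identityˡ _) (*-identityˡ _) ⟩
    Σ h + Σ h            ≡⟨ cong (Σ h +_) Σh≡-Σh ⟩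
    Σ h - Σ h            ≡⟨ -‿inverseʳ (Σ h) ⟩
    0#                   ∎)
    where
    open ≡-Reasoning
    Σh≡-Σh : Σ h ≡ - Σ h
    Σh≡-Σh = begin
      Σ h                  ≡⟨ sym (Σ-reindex -_ -_ -‿involutive -‿involutive h) ⟩
      Σ (h ∘ -_)           ≡⟨ Σ-cong (λ x → trans (odd x) (sym (-1*x≈-x (h x)))) ⟩
      Σ (λ x → - 1# * h x) ≡⟨ Σ-* (- 1#) h ⟩
      - 1# * Σ h           ≡⟨ -1*x≈-x (Σ h) ⟩
      - Σ h                ∎

-- If some nonzero c has c^k ≠ 1 then Σ x^k = 0;
-- such a c exists as soon as the k-th roots of unity fit in a list shorter
-- than q - 1, which we certify by factoring x^k - 1 into quadratics.
module PowerSums (F : FiniteField) where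
  open Summation F public

  short-list-incomplete : (L : List Carrier) → length L < size → ¬ (∀ x → x ∈ L)
  short-list-incomplete L short complete
    with Fin.pigeonhole short (λ i → Any.index (complete (to i)))
  ... | i , j , i<j , same-index = Fin.<⇒≢ i<j (begin
    i                     ≡⟨ sym (strictlyInverseʳ i) ⟩
    from (to i)           ≡⟨ cong from (trans (lookup-index (complete (to i))) (cong (lookup L) same-index)) ⟩
    from (lookup L j′)    ≡⟨ cong from (sym (lookup-index (complete (to j)))) ⟩
    from (to j)           ≡⟨ strictlyInverseʳ j ⟩
    j                     ∎)
    where
    open ≡-Reasoning
    j′ : Fin (length L)
    j′ = Any.index (complete (to j))

  -- Scaling x ↦ c x permutes F, so c^k · Σ x^k = Σ (c x)^k = Σ x^k; hence a
  -- nonzero power sum forces every nonzero c to be a k-th root of unity.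
  nonzero-powerSum⇒root-of-unity : ∀ k → Σ (_^ k) ≢ 0# → ∀ c → c ≢ 0# → c ^ k ≡ 1#
  nonzero-powerSum⇒root-of-unity k S≢0 c c≢0 = x∙y⁻¹≈ε⇒x≈y (c ^ k) 1# [c^k-1]S≡0
    where
    open ≡-Reasoning
    scaled : c ^ k * Σ (_^ k) ≡ Σ (_^ k)
    scaled = begin
      c ^ k * Σ (_^ k)          ≡⟨ sym (Σ-* (c ^ k) (_^ k)) ⟩
      Σ (λ x → c ^ k * x ^ k)   ≡⟨ Σ-cong (λ x → sym (^-distrib-* c x k)) ⟩
      Σ (λ x → (c * x) ^ k)     ≡⟨ Σ-reindex (c *_) (c ⁻¹ *_) (unscale c⁻¹c≡1) (unscale (⁻¹-inverse c c≢0)) (_^ k) ⟩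
      Σ (_^ k)                  ∎
      where
      open import Algebra.Properties.CommutativeSemiring.Exp (CommutativeRing.commutativeSemiring ring)
        using (^-distrib-*)
      c⁻¹c≡1 : c ⁻¹ * c ≡ 1#
      c⁻¹c≡1 = trans (*-comm _ _) (⁻¹-inverse c c≢0)
      unscale : ∀ {d e} → d * e ≡ 1# → ∀ x → d * (e * x) ≡ x
      unscale de≡1 x = trans (sym (*-assoc _ _ x)) (trans (cong (_* x) de≡1) (*-identityˡ x))
    [c^k-1]S≡0 : c ^ k - 1# ≡ 0#
    [c^k-1]S≡0 = cancel-nonzero S≢0 (begin
      Σ (_^ k) * (c ^ k - 1#)                 ≡⟨ expand (Σ (_^ k)) (c ^ k) ⟩
      c ^ k * Σ (_^ k) - Σ (_^ k)             ≡⟨ cong (_- Σ (_^ k)) scaled ⟩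
      Σ (_^ k) - Σ (_^ k)                     ≡⟨ -‿inverseʳ _ ⟩
      0#                                      ∎)
      where
      expand : ∀ S p → S * (p - 1#) ≡ p * S - S
      expand = solve 2 (λ S p → S :* (p :- con (pos 1)) := p :* S :- S) refl

  quadratic : Carrier → Carrier → Carrier → Carrier
  quadratic β γ x = x * x + β * x + γ

  quadraticRoots : Carrier → Carrier → List Carrier
  quadraticRoots β γ with Fin.any? (λ i → quadratic β γ (to i) ≟ 0#)
  ... | yes (i , _) = to i ∷ (- β - to i) ∷ []
  ... | no _        = []

  quadraticRoots-length : ∀ β γ → length (quadraticRoots β γ) ≤ 2
  quadraticRoots-length β γ with Fin.any? (λ i → quadratic β γ (to i) ≟ 0#)
  ... | yes _ = ℕ.≤-refl
  ... | no _  = ℕ.z≤n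

  quadratic-difference : ∀ β γ x t → quadratic β γ x - quadratic β γ t ≡ (x - t) * (x - (- β - t))
  quadratic-difference = solve 4 (λ β γ x t → (x :* x :+ β :* x :+ γ) :- (t :* t :+ β :* t :+ γ)
                                              := (x :- t) :* (x :- (:- β :- t))) refl

  quadraticRoots-complete : ∀ β γ x → quadratic β γ x ≡ 0# → x ∈ quadraticRoots β γ
  quadraticRoots-complete β γ x root with Fin.any? (λ i → quadratic β γ (to i) ≟ 0#)
  ... | no no-root = ⊥-elim (no-root (from x , trans (cong (quadratic β γ) (strictlyInverseˡ x)) root))
  ... | yes (i , root′)
    with zero-product (trans (sym (quadratic-difference β γ x (to i)))
                             (trans (cong₂ _-_ root root′) (-‿inverseʳ 0#)))
  ...   | inj₁ x-t≡0  = here (x∙y⁻¹≈ε⇒x≈y _ _ x-t≡0)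
  ...   | inj₂ x-t′≡0 = there (here (x∙y⁻¹≈ε⇒x≈y _ _ x-t′≡0))

  quadraticProduct : List (Carrier × Carrier) → Carrier → Carrier
  quadraticProduct []             x = 1#
  quadraticProduct ((β , γ) ∷ qs) x = quadratic β γ x * quadraticProduct qs x

  productRoots : List (Carrier × Carrier) → List Carrier
  productRoots []             = []
  productRoots ((β , γ) ∷ qs) = quadraticRoots β γ ++ productRoots qs

  productRoots-length : ∀ qs → length (productRoots qs) ≤ 2 ℕ.* length qs
  productRoots-length [] = ℕ.z≤n
  productRoots-length ((β , γ) ∷ qs) = begin
    length (quadraticRoots β γ ++ productRoots qs)           ≡⟨ List.length-++ (quadraticRoots β γ) ⟩
    length (quadraticRoots β γ) ℕ.+ length (productRoots qs) ≤⟨ ℕ.+-mono-≤ (quadraticRoots-length β γ) (productRoots-length qs) ⟩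
    2 ℕ.+ 2 ℕ.* length qs                                    ≡⟨ sym (ℕ.*-suc 2 (length qs)) ⟩
    2 ℕ.* suc (length qs)                                    ∎
    where open ℕ.≤-Reasoning

  productRoots-complete : ∀ qs x → quadraticProduct qs x ≡ 0# → x ∈ productRoots qs
  productRoots-complete []             x 1≡0 = ⊥-elim (0≢1 (sym 1≡0))
  productRoots-complete ((β , γ) ∷ qs) x root with zero-product root
  ... | inj₁ root₁ = ∈-++⁺ˡ (quadraticRoots-complete β γ x root₁)
  ... | inj₂ root₂ = ∈-++⁺ʳ (quadraticRoots β γ) (productRoots-complete qs x root₂)

  -- If x^k - 1 factors into m quadratics and 2m + 1 < q, then Σ x^k = 0:
  -- otherwise 0 and the at most 2m roots of unity would exhaust F.
  powerSum-vanishes : ∀ k qs → suc (2 ℕ.* length qs) < size →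
                      (∀ x → x ^ k - 1# ≡ quadraticProduct qs x) → Σ (_^ k) ≡ 0#
  powerSum-vanishes k qs small factorisation with Σ (_^ k) ≟ 0#
  ... | yes S≡0 = S≡0
  ... | no S≢0  = ⊥-elim (short-list-incomplete (0# ∷ productRoots qs)
                    (ℕ.≤-<-trans (s≤s (productRoots-length qs)) small) complete)
    where
    complete : ∀ x → x ∈ 0# ∷ productRoots qs
    complete x with x ≟ 0#
    ... | yes x≡0 = here x≡0
    ... | no x≢0  = there (productRoots-complete qs x (trans (sym (factorisation x))
                      (x≈y⇒x∙y⁻¹≈ε (nonzero-powerSum⇒root-of-unity k S≢0 x x≢0))))

  Σx³≡0 : 1# + 1# ≢ 0# → Σ (_^ 3) ≡ 0#
  Σx³≡0 two≢0 = Σ-odd two≢0 (_^ 3) (solve 1 (λ x → (:- x) :^ 3 := :- (x :^ 3)) refl)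

  -- For q > 7 the power sums of degree 2, 4 and 6 vanish, via
  -- x² - 1 = x² - 1,  x⁴ - 1 = (x² - 1)(x² + 1),  x⁶ - 1 = (x² - 1)(x² + x + 1)(x² - x + 1).
  module _ (q>7 : 7 < size) where
    private
      below-q : ∀ {m} → m ≤ 7 → m < size
      below-q m≤7 = ℕ.≤-trans (s≤s m≤7) q>7

    Σx²≡0 : Σ (_^ 2) ≡ 0#
    Σx²≡0 = powerSum-vanishes 2 ((0# , - 1#) ∷ []) (below-q (ℕ.m≤m+n 3 4))
      (solve 1 (λ x → x :^ 2 :- con (pos 1)
                      := (x :* x :+ con (pos 0) :* x :- con (pos 1)) :* con (pos 1)) refl)

    Σx⁴≡0 : Σ (_^ 4) ≡ 0#
    Σx⁴≡0 = powerSum-vanishes 4 ((0# , - 1#) ∷ (0# , 1#) ∷ []) (below-q (ℕ.m≤m+n 5 2))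
      (solve 1 (λ x → x :^ 4 :- con (pos 1)
                      := (x :* x :+ con (pos 0) :* x :- con (pos 1))
                         :* ((x :* x :+ con (pos 0) :* x :+ con (pos 1)) :* con (pos 1))) refl)

    Σx⁶≡0 : Σ (_^ 6) ≡ 0#
    Σx⁶≡0 = powerSum-vanishes 6 ((0# , - 1#) ∷ (1# , 1#) ∷ (- 1# , 1#) ∷ []) (below-q ℕ.≤-refl)
      (solve 1 (λ x → x :^ 6 :- con (pos 1)
                      := (x :* x :+ con (pos 0) :* x :- con (pos 1))
                         :* ((x :* x :+ con (pos 1) :* x :+ con (pos 1))
                         :* ((x :* x :+ (:- con (pos 1)) :* x :+ con (pos 1)) :* con (pos 1)))) refl)

module RationalFunction (F : FiniteField) (a b s : FiniteField.Carrier F)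
                        (s-nonsquare : ¬ IsSquare F s) where
  open PowerSums F public

  -- 0 = 0² is a square.
  s≢0 : s ≢ 0#
  s≢0 s≡0 = s-nonsquare (0# , trans (zeroˡ 0#) (sym s≡0))

  Q : Carrier → Carrier
  Q = eval F (fDen F s)

  Q-value : ∀ x → Q x ≡ x ^ 2 - s
  Q-value x = solve 2 (λ x s → :- s :+ x :* (con (pos 0) :+ x :* (con (pos 1) :+ x :* con (pos 0)))
                               := x :^ 2 :- s) refl x s

  Q-nonzero : ∀ x → Q x ≢ 0#
  Q-nonzero x Qx≡0 = s-nonsquare (x , x∙y⁻¹≈ε⇒x≈y (x * x) s (begin
    x * x - s     ≡⟨ cong (_- s) (square x) ⟩
    x ^ 2 - s     ≡⟨ sym (Q-value x) ⟩
    Q x           ≡⟨ Qx≡0 ⟩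
    0#            ∎))
    where
    open ≡-Reasoning
    square : ∀ x → x * x ≡ x ^ 2
    square = solve 1 (λ x → x :* x := x :^ 2) refl

  square-neg : ∀ x → (- x) ^ 2 ≡ x ^ 2
  square-neg = solve 1 (λ x → (:- x) :^ 2 := x :^ 2) refl

  u : Carrier → Carrier
  u x = Q x ⁻¹

  u-relation : ∀ x → (x ^ 2 - s) * u x ≡ 1#
  u-relation x = trans (cong (_* u x) (sym (Q-value x))) (⁻¹-inverse (Q x) (Q-nonzero x))

  u-even : ∀ x → u (- x) ≡ u x
  u-even x = cong _⁻¹ (trans (Q-value (- x)) (trans (cong (_- s) (square-neg x)) (sym (Q-value x))))

  φ : Carrier → Carrier
  φ x = a * x ^ 2 + b * x + # 2 * x * u x

  -- P(x) = (a x² + b x)(x² - s) + 2x, so P(x)/Q(x) = φ(x).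
  P/Q-value : ∀ x → eval F (fNum F a b s) x * u x ≡ φ x
  P/Q-value x = modulo (a * x ^ 2 + b * x) (u-relation x)
    (solve 5 (λ x U a b s →
       (con (pos 0) :+ x :* ((con (pos 2) :- b :* s) :+ x :* (:- (a :* s)
         :+ x :* (b :+ x :* (a :+ x :* con (pos 0)))))) :* U
       := (a :* x :^ 2 :+ b :* x :+ con (pos 2) :* x :* U)
          :+ (a :* x :^ 2 :+ b :* x) :* ((x :^ 2 :- s) :* U :- con (pos 1))) refl x (u x) a b s)

  ratMap-finite : ∀ x → ratMap F (fNum F a b s) (fDen F s) (just x) ≡ just (φ x)
  ratMap-finite x with Q x ≟ 0#
  ... | yes Qx≡0 = ⊥-elim (Q-nonzero x Qx≡0)
  ... | no _     = cong just (P/Q-value x)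

  -- f(∞) = ∞ since deg P = 4 > 2 = deg Q.
  ratMap-∞ : a ≢ 0# → ratMap F (fNum F a b s) (fDen F s) nothing ≡ nothing
  ratMap-∞ a≢0 with a ≟ 0# | 1# ≟ 0#
  ... | yes a≡0 | _       = ⊥-elim (a≢0 a≡0)
  ... | no _    | yes 1≡0 = ⊥-elim (0≢1 (sym 1≡0))
  ... | no _    | no _    = refl

  -- Since f fixes ∞, a permutation of P¹ restricts to a permutation φ of F,
  -- so summing any function after φ does not change the sum.
  Σ-φ : a ≢ 0# → IsPermutationRational F (fNum F a b s) (fDen F s) → ∀ h → Σ (h ∘ φ) ≡ Σ h
  Σ-φ a≢0 (injective , surjective) =
    Σ-reindex φ (proj₁ ∘ preimage) (λ x → φ-injective (proj₂ (preimage (φ x)))) (proj₂ ∘ preimage)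
    where
    φ-injective : ∀ {x y} → φ x ≡ φ y → x ≡ y
    φ-injective {x} {y} φx≡φy =
      just-injective (injective (trans (ratMap-finite x) (trans (cong just φx≡φy) (sym (ratMap-finite y)))))
    preimage : ∀ y → Σ[ x ∈ Carrier ] φ x ≡ y
    preimage y with surjective (just y)
    ... | nothing , hits = ⊥-elim (nothing≢just (trans (sym (ratMap-∞ a≢0)) (hits refl)))
      where
      nothing≢just : nothing ≢ just y
      nothing≢just ()
    ... | just x  , hits = x , just-injective (trans (sym (ratMap-finite x)) (hits refl))

  -- The involution x ↦ s/x of F (with 0 ↦ 0) turns u into -1/s - u away from 0.
  ψ : Carrier → Carrier
  ψ x with x ≟ 0#
  ... | yes _ = 0#
  ... | no _  = s * x ⁻¹

  ψ-zero : ψ 0# ≡ 0#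
  ψ-zero with 0# ≟ 0#
  ... | yes _  = refl
  ... | no 0≢0 = ⊥-elim (0≢0 refl)

  ψ-nonzero : ∀ x → x ≢ 0# → ψ x ≡ s * x ⁻¹
  ψ-nonzero x x≢0 with x ≟ 0#
  ... | yes x≡0 = ⊥-elim (x≢0 x≡0)
  ... | no _    = refl

  -- For x ≠ 0, (s/x)⁻¹ = x/s, hence ψ (ψ x) = s · x/s = x.
  ψ-involutive : ∀ x → ψ (ψ x) ≡ x
  ψ-involutive x with x ≟ 0#
  ... | yes x≡0 = trans ψ-zero (sym x≡0)
  ... | no x≢0  = begin
    ψ (s * x ⁻¹)            ≡⟨ ψ-nonzero (s * x ⁻¹) (nonzero-* s≢0 (⁻¹-nonzero x≢0)) ⟩
    s * (s * x ⁻¹) ⁻¹       ≡⟨ cong (s *_) (inverse-unique (trans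
                                 (modulo (s * s ⁻¹) (⁻¹-inverse x x≢0) (s/x·x/s x (x ⁻¹) s (s ⁻¹)))
                                 (modulo 1# (⁻¹-inverse s s≢0) refl))) ⟩
    s * (x * s ⁻¹)          ≡⟨ modulo x (⁻¹-inverse s s≢0) (s·x/s x s (s ⁻¹)) ⟩
    x                       ∎
    where
    open ≡-Reasoning
    s/x·x/s : ∀ x ix s is → s * ix * (x * is) ≡ (1# + 1# * (s * is - 1#)) + s * is * (x * ix - 1#)
    s/x·x/s = solve 4 (λ x ix s is → s :* ix :* (x :* is)
      := (con (pos 1) :+ con (pos 1) :* (s :* is :- con (pos 1))) :+ s :* is :* (x :* ix :- con (pos 1))) refl
    s·x/s : ∀ x s is → s * (x * is) ≡ x + x * (s * is - 1#)
    s·x/s = solve 3 (λ x s is → s :* (x :* is) := x :+ x :* (s :* is :- con (pos 1))) refl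

  u-zero : u 0# ≡ - (s ⁻¹)
  u-zero = inverse-unique (begin
    Q 0# * - (s ⁻¹)           ≡⟨ cong (_* - (s ⁻¹)) (Q-value 0#) ⟩
    (0# ^ 2 - s) * - (s ⁻¹)   ≡⟨ modulo 1# (⁻¹-inverse s s≢0) (identity s (s ⁻¹)) ⟩
    1#                        ∎)
    where
    open ≡-Reasoning
    identity : ∀ s is → (0# ^ 2 - s) * - is ≡ 1# + 1# * (s * is - 1#)
    identity = solve 2 (λ s is → (con (pos 0) :^ 2 :- s) :* (:- is)
                                 := con (pos 1) :+ con (pos 1) :* (s :* is :- con (pos 1))) refl

  -- u (s/x) = -1/s - u x for x ≠ 0; the identity below holds modulo the
  -- relations x · x⁻¹ = 1, (x² - s) · u x = 1 and s · s⁻¹ = 1.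
  u-ψ : ∀ x → x ≢ 0# → u (ψ x) ≡ - (s ⁻¹) - u x
  u-ψ x x≢0 = trans (cong u (ψ-nonzero x x≢0)) (inverse-unique (begin
    Q (s * x ⁻¹) * (- (s ⁻¹) - u x)               ≡⟨ cong (_* (- (s ⁻¹) - u x)) (Q-value (s * x ⁻¹)) ⟩
    ((s * x ⁻¹) ^ 2 - s) * (- (s ⁻¹) - u x)       ≡⟨ modulo (- (s * u x) * (x * x ⁻¹ + 1#)) (⁻¹-inverse x x≢0)
                                                       (identity x (x ⁻¹) s (s ⁻¹) (u x)) ⟩
    (1# + (1# - s * x ⁻¹ * x ⁻¹) * (s * s ⁻¹ - 1#)) + s * x ⁻¹ * x ⁻¹ * ((x ^ 2 - s) * u x - 1#)
                                                  ≡⟨ modulo (s * x ⁻¹ * x ⁻¹) (u-relation x) refl ⟩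
    1# + (1# - s * x ⁻¹ * x ⁻¹) * (s * s ⁻¹ - 1#)
                                                  ≡⟨ modulo (1# - s * x ⁻¹ * x ⁻¹) (⁻¹-inverse s s≢0) refl ⟩
    1#                                            ∎))
    where
    open ≡-Reasoning
    identity : ∀ x ix s is U → ((s * ix) ^ 2 - s) * (- is - U)
               ≡ ((1# + (1# - s * ix * ix) * (s * is - 1#)) + s * ix * ix * ((x ^ 2 - s) * U - 1#))
                 + - (s * U) * (x * ix + 1#) * (x * ix - 1#)
    identity = solve 5 (λ x ix s is U → ((s :* ix) :^ 2 :- s) :* (:- is :- U)
      := ((con (pos 1) :+ (con (pos 1) :- s :* ix :* ix) :* (s :* is :- con (pos 1)))
          :+ s :* ix :* ix :* ((x :^ 2 :- s) :* U :- con (pos 1)))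
         :+ :- (s :* U) :* (x :* ix :+ con (pos 1)) :* (x :* ix :- con (pos 1))) refl

  S₁ : Carrier
  S₁ = Σ u

  S₁+S₁ : S₁ + S₁ ≡ - (s ⁻¹)
  S₁+S₁ = begin
    S₁ + S₁                                 ≡⟨ cong (_+ S₁) (sym (Σ-reindex ψ ψ ψ-involutive ψ-involutive u)) ⟩
    Σ (u ∘ ψ) + S₁                          ≡⟨ sym (+-identityʳ _) ⟩
    Σ (u ∘ ψ) + S₁ + 0#                     ≡⟨ cong₂ _+_ (sym (Σ-+ (u ∘ ψ) u)) (sym (Σ-const (s ⁻¹))) ⟩
    Σ (λ x → u (ψ x) + u x) + Σ (λ _ → s ⁻¹)
                                            ≡⟨ sym (Σ-+ (λ x → u (ψ x) + u x) (λ _ → s ⁻¹)) ⟩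
    Σ v                                     ≡⟨ Σ-single v 0# v-vanishes ⟩
    u (ψ 0#) + u 0# + s ⁻¹                  ≡⟨ cong (λ y → u y + u 0# + s ⁻¹) ψ-zero ⟩
    u 0# + u 0# + s ⁻¹                      ≡⟨ cong (λ y → y + y + s ⁻¹) u-zero ⟩
    - (s ⁻¹) + - (s ⁻¹) + s ⁻¹              ≡⟨ cancel (s ⁻¹) ⟩
    - (s ⁻¹)                                ∎
    where
    open ≡-Reasoning
    v : Carrier → Carrier
    v x = u (ψ x) + u x + s ⁻¹
    cancel : ∀ i → - i + - i + i ≡ - i
    cancel = solve 1 (λ i → :- i :+ :- i :+ i := :- i) refl
    v-vanishes : ∀ x → x ≢ 0# → v x ≡ 0#
    v-vanishes x x≢0 = trans (cong (λ y → y + u x + s ⁻¹) (u-ψ x x≢0)) (vanish (s ⁻¹) (u x))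
      where
      vanish : ∀ i U → - i - U + U + i ≡ 0#
      vanish = solve 2 (λ i U → :- i :- U :+ U :+ i := con (pos 0)) refl

  S₁≢0 : S₁ ≢ 0#
  S₁≢0 S₁≡0 = ⁻¹-nonzero s≢0 (-‿injective (begin
    - (s ⁻¹)   ≡⟨ sym S₁+S₁ ⟩
    S₁ + S₁    ≡⟨ cong₂ _+_ S₁≡0 S₁≡0 ⟩
    0# + 0#    ≡⟨ +-identityʳ 0# ⟩
    0#         ≡⟨ sym -0#≈0# ⟩
    - 0#       ∎))
    where open ≡-Reasoning

  S₂ : Carrier
  S₂ = Σ (λ x → u x ^ 2)

  module PowerSumsOfφ (two≢0 : 1# + 1# ≢ 0#) (q>7 : 7 < size) where
    -- (A record rather than a synonym, so that h can be inferred from Null h.)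
    record Null (h : Carrier → Carrier) : Set where
      constructor null
      field Σ≡0 : Σ h ≡ 0#

    null-+ : ∀ {g h} → Null g → Null h → Null (λ x → g x + h x)
    null-+ {g} {h} (null g-null) (null h-null) =
      null (trans (Σ-+ g h) (trans (cong₂ _+_ g-null h-null) (+-identityʳ 0#)))

    null-* : ∀ c {h} → Null h → Null (λ x → c * h x)
    null-* c {h} (null h-null) = null (trans (Σ-* c h) (trans (cong (c *_) h-null) (zeroʳ c)))

    null-const : ∀ c → Null (λ _ → c)
    null-const c = null (Σ-const c)

    -- x ↦ x · R(x², u x) is odd, u being even.
    null-odd : ∀ (R : Carrier → Carrier → Carrier) → Null (λ x → x * R (x ^ 2) (u x))
    null-odd R = null (Σ-odd two≢0 (λ x → x * R (x ^ 2) (u x)) (λ x → begin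
      - x * R ((- x) ^ 2) (u (- x))  ≡⟨ cong₂ (λ X U → - x * R X U) (square-neg x) (u-even x) ⟩
      - x * R (x ^ 2) (u x)          ≡⟨ sym (-‿distribˡ-* x (R (x ^ 2) (u x))) ⟩
      - (x * R (x ^ 2) (u x))        ∎))
      where open ≡-Reasoning

    Σ-reduce : ∀ c₁ c₂ {N} → Null N → Σ (λ x → (c₁ * u x + c₂ * u x ^ 2) + N x) ≡ c₁ * S₁ + c₂ * S₂
    Σ-reduce c₁ c₂ {N} (null N-null) = begin
      Σ (λ x → (c₁ * u x + c₂ * u x ^ 2) + N x)                 ≡⟨ Σ-+ (λ x → c₁ * u x + c₂ * u x ^ 2) N ⟩
      Σ (λ x → c₁ * u x + c₂ * u x ^ 2) + Σ N                   ≡⟨ cong₂ _+_ (Σ-+ (λ x → c₁ * u x) (λ x → c₂ * u x ^ 2)) N-null ⟩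
      (Σ (λ x → c₁ * u x) + Σ (λ x → c₂ * u x ^ 2)) + 0#        ≡⟨ +-identityʳ _ ⟩
      Σ (λ x → c₁ * u x) + Σ (λ x → c₂ * u x ^ 2)               ≡⟨ cong₂ _+_ (Σ-* c₁ u) (Σ-* c₂ (λ x → u x ^ 2)) ⟩
      c₁ * S₁ + c₂ * S₂                                         ∎
      where open ≡-Reasoning

    R₂ : Carrier → Carrier → Carrier
    R₂ X U = # 2 * a * b * X + # 4 * a * (X * U)

    N₂ : Carrier → Carrier
    N₂ x = a * a * x ^ 4 + b * b * x ^ 2 + # 4 * b + x * R₂ (x ^ 2) (u x)

    φ²-expansion : ∀ x → φ x ^ 2 ≡ ((# 4 * b * s + # 4) * u x + # 4 * s * u x ^ 2) + N₂ x
    φ²-expansion x = modulo (# 4 * b + # 4 * u x) (u-relation x)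
      (solve 5 (λ x U a b s → (a :* x :^ 2 :+ b :* x :+ con (pos 2) :* x :* U) :^ 2
        := (((con (pos 4) :* b :* s :+ con (pos 4)) :* U :+ con (pos 4) :* s :* U :^ 2)
            :+ (a :* a :* x :^ 4 :+ b :* b :* x :^ 2 :+ con (pos 4) :* b
                :+ x :* (con (pos 2) :* a :* b :* x :^ 2 :+ con (pos 4) :* a :* (x :^ 2 :* U))))
           :+ (con (pos 4) :* b :+ con (pos 4) :* U) :* ((x :^ 2 :- s) :* U :- con (pos 1))) refl
        x (u x) a b s)

    Σφ² : Σ (λ x → φ x ^ 2) ≡ (# 4 * b * s + # 4) * S₁ + # 4 * s * S₂
    Σφ² = trans (Σ-cong φ²-expansion) (Σ-reduce _ _ N₂-null)
      where
      N₂-null : Null N₂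
      N₂-null = null-+ (null-+ (null-+ (null-* (a * a) (null (Σx⁴≡0 q>7))) (null-* (b * b) (null (Σx²≡0 q>7))))
                                (null-const (# 4 * b)))
                       (null-odd R₂)

    R₃ : Carrier → Carrier → Carrier
    R₃ X U = # 3 * a * a * b * X ^ 2 + b * b * b * X + # 6 * a * a * (X ^ 2 * U) + # 6 * b * b * (X * U)
             + # 12 * b * (X * U ^ 2) + # 8 * (X * U ^ 3)

    N₃ : Carrier → Carrier
    N₃ x = a * a * a * x ^ 6 + # 3 * a * b * b * x ^ 4 + # 12 * a * b * x ^ 2
           + (# 12 * a * b * s + # 12 * a) + x * R₃ (x ^ 2) (u x)

    φ³-expansion : ∀ x → φ x ^ 3 ≡ ((# 12 * a * b * s ^ 2 + # 24 * a * s) * u x + # 12 * a * s ^ 2 * u x ^ 2) + N₃ x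
    φ³-expansion x = modulo (# 12 * a * (1# + b * s + u x * s + x ^ 2 * b + x ^ 2 * u x)) (u-relation x)
      (solve 5 (λ x U a b s → (a :* x :^ 2 :+ b :* x :+ con (pos 2) :* x :* U) :^ 3
        := (((con (pos 12) :* a :* b :* s :^ 2 :+ con (pos 24) :* a :* s) :* U
              :+ con (pos 12) :* a :* s :^ 2 :* U :^ 2)
            :+ (a :* a :* a :* x :^ 6 :+ con (pos 3) :* a :* b :* b :* x :^ 4
                :+ con (pos 12) :* a :* b :* x :^ 2 :+ (con (pos 12) :* a :* b :* s :+ con (pos 12) :* a)
                :+ x :* (con (pos 3) :* a :* a :* b :* (x :^ 2) :^ 2 :+ b :* b :* b :* x :^ 2
                         :+ con (pos 6) :* a :* a :* ((x :^ 2) :^ 2 :* U) :+ con (pos 6) :* b :* b :* (x :^ 2 :* U)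
                         :+ con (pos 12) :* b :* (x :^ 2 :* U :^ 2) :+ con (pos 8) :* (x :^ 2 :* U :^ 3))))
           :+ con (pos 12) :* a :* (con (pos 1) :+ b :* s :+ U :* s :+ x :^ 2 :* b :+ x :^ 2 :* U)
              :* ((x :^ 2 :- s) :* U :- con (pos 1))) refl
        x (u x) a b s)

    Σφ³ : Σ (λ x → φ x ^ 3) ≡ (# 12 * a * b * s ^ 2 + # 24 * a * s) * S₁ + # 12 * a * s ^ 2 * S₂
    Σφ³ = trans (Σ-cong φ³-expansion) (Σ-reduce _ _ N₃-null)
      where
      N₃-null : Null N₃
      N₃-null = null-+ (null-+ (null-+ (null-+ (null-* (a * a * a) (null (Σx⁶≡0 q>7)))
                                                (null-* (# 3 * a * b * b) (null (Σx⁴≡0 q>7))))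
                                       (null-* (# 12 * a * b) (null (Σx²≡0 q>7))))
                                (null-const (# 12 * a * b * s + # 12 * a)))
                       (null-odd R₃)

    -- If f permutes P¹, then Σ φ² = Σ x² = 0 and Σ φ³ = Σ x³ = 0; eliminating
    -- S₂ between the two resulting linear equations leaves 12 a s S₁ = 0.
    permutation⇒12asS₁≡0 : a ≢ 0# → IsPermutationRational F (fNum F a b s) (fDen F s) → # 12 * a * s * S₁ ≡ 0#
    permutation⇒12asS₁≡0 a≢0 perm = -‿injective (begin
      - (# 12 * a * s * S₁)                     ≡⟨ sym (eliminate a b s S₁ S₂) ⟩
      # 3 * a * s * E₂ - E₃                     ≡⟨ cong₂ (λ e₂ e₃ → # 3 * a * s * e₂ - e₃) E₂≡0 E₃≡0 ⟩
      # 3 * a * s * 0# - 0#                     ≡⟨ cong (_- 0#) (zeroʳ _) ⟩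
      0# - 0#                                   ≡⟨ -‿inverseʳ 0# ⟩
      0#                                        ≡⟨ sym -0#≈0# ⟩
      - 0#                                      ∎)
      where
      open ≡-Reasoning
      E₂ E₃ : Carrier
      E₂ = (# 4 * b * s + # 4) * S₁ + # 4 * s * S₂
      E₃ = (# 12 * a * b * s ^ 2 + # 24 * a * s) * S₁ + # 12 * a * s ^ 2 * S₂
      E₂≡0 : E₂ ≡ 0#
      E₂≡0 = trans (sym Σφ²) (trans (Σ-φ a≢0 perm (_^ 2)) (Σx²≡0 q>7))
      E₃≡0 : E₃ ≡ 0#
      E₃≡0 = trans (sym Σφ³) (trans (Σ-φ a≢0 perm (_^ 3)) (Σx³≡0 two≢0))
      eliminate : ∀ a b s S₁ S₂ →
        # 3 * a * s * ((# 4 * b * s + # 4) * S₁ + # 4 * s * S₂)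
          - ((# 12 * a * b * s ^ 2 + # 24 * a * s) * S₁ + # 12 * a * s ^ 2 * S₂)
        ≡ - (# 12 * a * s * S₁)
      eliminate = solve 5 (λ a b s S₁ S₂ →
        con (pos 3) :* a :* s :* ((con (pos 4) :* b :* s :+ con (pos 4)) :* S₁ :+ con (pos 4) :* s :* S₂)
          :- ((con (pos 12) :* a :* b :* s :^ 2 :+ con (pos 24) :* a :* s) :* S₁ :+ con (pos 12) :* a :* s :^ 2 :* S₂)
        := :- (con (pos 12) :* a :* s :* S₁)) refl


theorem4p2 : (F : FiniteField) →
    7 < FiniteField.size F →
    (FiniteField._+_ F (FiniteField.1# F) (FiniteField.1# F)) ≢ FiniteField.0# F →
    (FiniteField._+_ F (FiniteField._+_ F (FiniteField.1# F) (FiniteField.1# F)) (FiniteField.1# F)) ≢ FiniteField.0# F →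
    (a b s : FiniteField.Carrier F) →
    a ≢ FiniteField.0# F →
    ¬ IsSquare F s →
    ¬ IsPermutationRational F (fNum F a b s) (fDen F s)
theorem4p2 F q>7 two≢0 three≢0 a b s a≢0 s-nonsquare perm =
  S₁≢0 (cancel-nonzero 12as≢0 (permutation⇒12asS₁≡0 a≢0 perm))
  where
  open RationalFunction F a b s s-nonsquare
  open PowerSumsOfφ two≢0 q>7
  12as≢0 : # 12 * a * s ≢ 0#
  12as≢0 = nonzero-* (nonzero-* (twelve≢0 two≢0 three≢0) a≢0) s≢0
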